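{- Let $G$ be a finite simple graph, $\Lambda\subseteq\Omega(G)$, $|\Lambda|\ge 1$. Then $G$ is a König–Egerváry graph if and only if $\bigcup\Lambda$ is critical and $\left|\bigcap\Lambda\right|+\left|\bigcup\Lambda\right|=2\alpha(G)$.
   Context: For $X\subseteq V(G)$, $N(X)$ is the set of vertices adjacent to some vertex of $X$, $d(X)=|X|-|N(X)|$, $d(G)=\max\{d(X):X\subseteq V(G)\}$, and $X$ is critical if $d(X)=d(G)$. $\alpha(G)$ is the maximum cardinality of an independent set, $\Omega(G)$ the family of maximum independent sets, $\mu(G)$ the size of a maximum matching. $G$ is König–Egerváry if $\alpha(G)+\mu(G)=|V(G)|$. -}

module Defs where

open import Data.Nat using (ℕ; _≤_; _+_)
open import Data.Integer as ℤ using (ℤ; +_)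
open import Data.Bool using (Bool; true; false)
open import Data.Fin using (Fin)
open import Data.Fin.Subset using (Subset; _∈_; ∣_∣)
open import Data.Fin.Subset.Properties using (_∈?_)
open import Data.Fin.Properties using (any?)
open import Data.Vec using (tabulate)
open import Data.List using (List; length; map; concatMap; _∷_; [])
open import Data.List.Relation.Unary.All using (All)
open import Data.List.Relation.Unary.Unique.Propositional using (Unique)
open import Data.Product using (Σ; _×_; _,_; proj₁; proj₂)
open import Relation.Binary.PropositionalEquality using (_≡_)
open import Relation.Nullary using (does)
open import Relation.Nullary.Decidable using (_×-dec_)
open import Data.Bool.Properties using () renaming (_≟_ to _≟B_)

record Graph (n : ℕ) : Set where
  field
    adj    : Fin n → Fin n → Bool
    sym    : ∀ u v → adj u v ≡ adj v u
    irrefl : ∀ v → adj v v ≡ false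
open Graph public

module _ {n : ℕ} (G : Graph n) where

  N : Subset n → Subset n
  N X = tabulate λ v → does (any? λ u → (u ∈? X) ×-dec (adj G u v ≟B true))

  d : Subset n → ℤ
  d X = + ∣ X ∣ ℤ.- + ∣ N X ∣

  -- X is critical iff d(X) = d(G) = max_Y d(Y), i.e. d(Y) ≤ d(X) for all Y
  Critical : Subset n → Set
  Critical X = ∀ Y → d Y ℤ.≤ d X

  Independent : Subset n → Set
  Independent S = ∀ u v → u ∈ S → v ∈ S → adj G u v ≡ false

  MaxIndependent : Subset n → Set
  MaxIndependent S = Independent S × (∀ T → Independent T → ∣ T ∣ ≤ ∣ S ∣)

  IsIndependenceNumber : ℕ → Set
  IsIndependenceNumber a =
    Σ (Subset n) (λ S → Independent S × ∣ S ∣ ≡ a)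
    × (∀ T → Independent T → ∣ T ∣ ≤ a)

  -- A matching: a list of edges with pairwise distinct endpoints
  -- (so the edges are pairwise vertex-disjoint; each edge listed once).
  endpoints : List (Fin n × Fin n) → List (Fin n)
  endpoints = concatMap (λ e → proj₁ e ∷ proj₂ e ∷ [])

  Matching : List (Fin n × Fin n) → Set
  Matching M = All (λ e → adj G (proj₁ e) (proj₂ e) ≡ true) M × Unique (endpoints M)

  IsMatchingNumber : ℕ → Set
  IsMatchingNumber m =
    Σ (List (Fin n × Fin n)) (λ M → Matching M × length M ≡ m)
    × (∀ M → Matching M → length M ≤ m)

  KonigEgervary : Set
  KonigEgervary = Σ ℕ λ a → Σ ℕ λ m →
    IsIndependenceNumber a × IsMatchingNumber m × a + m ≡ n

-- Write n = |V(G)|. Every edge of a matching M meets ∁ Y and N(Y) at least twice in total,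
-- so |Y| + 2|M| ≤ n + |N(Y)|; hence in a König–Egerváry graph (μ = n − α) we get d(Y) ≤ 2α − n
-- for all Y. Conversely, if d(Y) ≤ 2α − n for all Y, then a maximum independent set S satisfies
-- Hall's condition for matching V ∖ S into S, so μ = n − α. Thus G is König–Egerváry iff
-- d(G) ≤ 2α − n.
-- For Λ ⊆ Ω(G) one has N(⋃ Λ) = V ∖ ⋂ Λ, so d(⋃ Λ) = |⋂ Λ| + |⋃ Λ| − n, while d(S) = 2α − n for
-- every S ∈ Ω(G). Because d is supermodular, unions of critical sets are critical. If G is
-- König–Egerváry, every S ∈ Λ is critical, hence so is ⋃ Λ, and comparing d(⋃ Λ) with d(S) and
-- with the bound 2α − n gives |⋂ Λ| + |⋃ Λ| = 2α. Conversely the two conditions say exactly that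
-- d(G) = d(⋃ Λ) = 2α − n.

module Submission where

open import Defs hiding (sym)

open import Data.Bool using (true; false; if_then_else_)
open import Data.Bool.Properties using (¬-not) renaming (_≟_ to _≟ᵇ_)
open import Data.Empty using (⊥-elim)
open import Data.Fin as Fin using (Fin)
open import Data.Fin.Properties using (any?)
open import Data.Fin.Subset
open import Data.Fin.Subset.Properties
import Data.Integer as ℤ
open import Data.List using (List; []; _∷_; map; length; filter; _++_)
open import Data.List.Properties using (length-++)
open import Data.List.Membership.Propositional using () renaming (_∈_ to _∈ˡ_)
open import Data.List.Relation.Unary.All as All using (All; []; _∷_)
import Data.List.Relation.Unary.All.Properties as All
open import Data.List.Relation.Unary.AllPairs using ([]; _∷_)
open import Data.List.Relation.Unary.Unique.Propositional using (Unique)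
import Data.List.Relation.Unary.Unique.Propositional.Properties as Unique
open import Data.Nat as ℕ using (ℕ; zero; suc; _+_; _*_; _≤_; _<_; z≤n; s≤s; s≤s⁻¹; _≤?_)
open import Data.Nat.ListAction using (sum)
open import Data.Nat.Properties
open import Data.Nat.Tactic.RingSolver using (solve-∀)
open import Algebra.Properties.CommutativeSemigroup +-commutativeSemigroup using (interchange)
open import Data.Product as Product using (Σ; ∃; _×_; _,_; proj₁; proj₂; uncurry)
open import Data.Sum using (_⊎_; inj₁; inj₂)
open import Data.Vec using (_∷_; []; here; there)
open import Data.Vec.Properties using (lookup∘tabulate; lookup⇒[]=; []=⇒lookup)
open import Function using (_∘_)
open import Function.Bundles using (_⇔_; mk⇔; Equivalence)
open import Relation.Binary.PropositionalEquality
open import Relation.Nullary using (¬_; Dec; yes; no; does)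
open import Relation.Nullary.Decidable using (dec-true; _×-dec_)

private variable
  n : ℕ

module _ where
  open import Data.Integer as ℤ using (+_; +≤+)
  open import Data.Integer.Properties as ℤ using (pos-+; drop‿+≤+)
  open import Data.Integer.Tactic.RingSolver using () renaming (solve-∀ to solve-∀ℤ)

  m-n≤o-p⇔m+p≤o+n : ∀ m n o p → (+ m ℤ.- + n ℤ.≤ + o ℤ.- + p) ⇔ (m ℕ.+ p ℕ.≤ o ℕ.+ n)
  m-n≤o-p⇔m+p≤o+n m n o p = mk⇔
    (λ m-n≤o-p → drop‿+≤+ (begin
      + (m ℕ.+ p)                       ≡⟨ pos-+ m p ⟩
      + m ℤ.+ + p                       ≡⟨ x+z≡[x-y]+[y+z] (+ m) (+ n) (+ p) ⟩
      (+ m ℤ.- + n) ℤ.+ (+ n ℤ.+ + p)   ≤⟨ ℤ.+-monoˡ-≤ (+ n ℤ.+ + p) m-n≤o-p ⟩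
      (+ o ℤ.- + p) ℤ.+ (+ n ℤ.+ + p)   ≡⟨ [x-y]+[z+y]≡x+z (+ o) (+ p) (+ n) ⟩
      + o ℤ.+ + n                       ≡⟨ pos-+ o n ⟨
      + (o ℕ.+ n)                       ∎))
    (λ m+p≤o+n → begin
      + m ℤ.- + n                         ≡⟨ x-y≡[x+z]-[y+z] (+ m) (+ n) (+ p) ⟩
      (+ m ℤ.+ + p) ℤ.- (+ n ℤ.+ + p)     ≡⟨ cong (ℤ._- (+ n ℤ.+ + p)) (pos-+ m p) ⟨
      + (m ℕ.+ p) ℤ.- (+ n ℤ.+ + p)       ≤⟨ ℤ.+-monoˡ-≤ (ℤ.- (+ n ℤ.+ + p)) (+≤+ m+p≤o+n) ⟩
      + (o ℕ.+ n) ℤ.- (+ n ℤ.+ + p)       ≡⟨ cong (ℤ._- (+ n ℤ.+ + p)) (pos-+ o n) ⟩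
      (+ o ℤ.+ + n) ℤ.- (+ n ℤ.+ + p)     ≡⟨ [x+z]-[z+y]≡x-y (+ o) (+ p) (+ n) ⟩
      + o ℤ.- + p                         ∎)
    where
    open ℤ.≤-Reasoning
    x+z≡[x-y]+[y+z] : ∀ x y z → x ℤ.+ z ≡ (x ℤ.- y) ℤ.+ (y ℤ.+ z)
    x+z≡[x-y]+[y+z] = solve-∀ℤ
    x-y≡[x+z]-[y+z] : ∀ x y z → x ℤ.- y ≡ (x ℤ.+ z) ℤ.- (y ℤ.+ z)
    x-y≡[x+z]-[y+z] = solve-∀ℤ
    [x-y]+[z+y]≡x+z : ∀ x y z → (x ℤ.- y) ℤ.+ (z ℤ.+ y) ≡ x ℤ.+ z
    [x-y]+[z+y]≡x+z = solve-∀ℤ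
    [x+z]-[z+y]≡x-y : ∀ x y z → (x ℤ.+ z) ℤ.- (z ℤ.+ y) ≡ x ℤ.- y
    [x+z]-[z+y]≡x-y = solve-∀ℤ

∣p∣+∣∁p∣≡n : (p : Subset n) → ∣ p ∣ + ∣ ∁ p ∣ ≡ n
∣p∣+∣∁p∣≡n p = trans (+-comm ∣ p ∣ ∣ ∁ p ∣) (trans (cong (_+ ∣ p ∣) (∣∁p∣≡n∸∣p∣ p)) (m∸n+n≡m (∣p∣≤n p)))

∣p∪q∣+∣p∩q∣≡∣p∣+∣q∣ : (p q : Subset n) → ∣ p ∪ q ∣ + ∣ p ∩ q ∣ ≡ ∣ p ∣ + ∣ q ∣
∣p∪q∣+∣p∩q∣≡∣p∣+∣q∣ []            []            = refl
∣p∪q∣+∣p∩q∣≡∣p∣+∣q∣ (outside ∷ p) (outside ∷ q) = ∣p∪q∣+∣p∩q∣≡∣p∣+∣q∣ p q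
∣p∪q∣+∣p∩q∣≡∣p∣+∣q∣ (inside  ∷ p) (outside ∷ q) = cong suc (∣p∪q∣+∣p∩q∣≡∣p∣+∣q∣ p q)
∣p∪q∣+∣p∩q∣≡∣p∣+∣q∣ (outside ∷ p) (inside  ∷ q) =
  trans (cong suc (∣p∪q∣+∣p∩q∣≡∣p∣+∣q∣ p q)) (sym (+-suc ∣ p ∣ ∣ q ∣))
∣p∪q∣+∣p∩q∣≡∣p∣+∣q∣ (inside  ∷ p) (inside  ∷ q) = cong suc (begin
  ∣ p ∪ q ∣ + suc ∣ p ∩ q ∣  ≡⟨ +-suc ∣ p ∪ q ∣ ∣ p ∩ q ∣ ⟩
  suc (∣ p ∪ q ∣ + ∣ p ∩ q ∣) ≡⟨ cong suc (∣p∪q∣+∣p∩q∣≡∣p∣+∣q∣ p q) ⟩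
  suc (∣ p ∣ + ∣ q ∣)         ≡⟨ +-suc ∣ p ∣ ∣ q ∣ ⟨
  ∣ p ∣ + suc ∣ q ∣           ∎)
  where open ≡-Reasoning

∣p∪q∣≤∣p∣+∣q∣ : (p q : Subset n) → ∣ p ∪ q ∣ ≤ ∣ p ∣ + ∣ q ∣
∣p∪q∣≤∣p∣+∣q∣ p q = ≤-trans (m≤m+n ∣ p ∪ q ∣ ∣ p ∩ q ∣) (≤-reflexive (∣p∪q∣+∣p∩q∣≡∣p∣+∣q∣ p q))

Disjoint : Subset n → Subset n → Set
Disjoint p q = ∀ {x} → x ∈ p → x ∉ q

Disjoint⇒∣p∪q∣≡∣p∣+∣q∣ : {p q : Subset n} → Disjoint p q → ∣ p ∪ q ∣ ≡ ∣ p ∣ + ∣ q ∣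
Disjoint⇒∣p∪q∣≡∣p∣+∣q∣ {n} {p} {q} p∩q=∅ = begin
  ∣ p ∪ q ∣             ≡⟨ +-identityʳ ∣ p ∪ q ∣ ⟨
  ∣ p ∪ q ∣ + 0         ≡⟨ cong (∣ p ∪ q ∣ +_) ∣p∩q∣≡0 ⟨
  ∣ p ∪ q ∣ + ∣ p ∩ q ∣ ≡⟨ ∣p∪q∣+∣p∩q∣≡∣p∣+∣q∣ p q ⟩
  ∣ p ∣ + ∣ q ∣         ∎
  where
  open ≡-Reasoning
  ∣p∩q∣≡0 : ∣ p ∩ q ∣ ≡ 0
  ∣p∩q∣≡0 = trans (cong ∣_∣ (Empty-unique λ (_ , x∈p∩q) → uncurry p∩q=∅ (x∈p∩q⁻ p q x∈p∩q))) (∣⊥∣≡0 n)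

x∈p─q⁻ : ∀ {x} (p q : Subset n) → x ∈ p ─ q → x ∈ p × x ∉ q
x∈p─q⁻ (inside  ∷ p) (outside ∷ q) here = here , λ ()
x∈p─q⁻ (_       ∷ p) (_       ∷ q) (there x∈p─q) with x∈p─q⁻ p q x∈p─q
... | x∈p , x∉q = there x∈p , λ { (there x∈q) → x∉q x∈q }
x∈p─q⁻ {x = Fin.zero} (outside ∷ p) (outside ∷ q) ()
x∈p─q⁻ {x = Fin.zero} (_       ∷ p) (inside  ∷ q) ()

q⊆r⇒Disjoint[q,p─r] : {p q r : Subset n} → q ⊆ r → Disjoint q (p ─ r)
q⊆r⇒Disjoint[q,p─r] {p = p} {r = r} q⊆r x∈q x∈p─r = proj₂ (x∈p─q⁻ p r x∈p─r) (q⊆r x∈q)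

∣p∣≡∣p∩q∣+∣p─q∣ : (p q : Subset n) → ∣ p ∣ ≡ ∣ p ∩ q ∣ + ∣ p ─ q ∣
∣p∣≡∣p∩q∣+∣p─q∣ []            []            = refl
∣p∣≡∣p∩q∣+∣p─q∣ (outside ∷ p) (outside ∷ q) = ∣p∣≡∣p∩q∣+∣p─q∣ p q
∣p∣≡∣p∩q∣+∣p─q∣ (outside ∷ p) (inside  ∷ q) = ∣p∣≡∣p∩q∣+∣p─q∣ p q
∣p∣≡∣p∩q∣+∣p─q∣ (inside  ∷ p) (inside  ∷ q) = cong suc (∣p∣≡∣p∩q∣+∣p─q∣ p q)
∣p∣≡∣p∩q∣+∣p─q∣ (inside  ∷ p) (outside ∷ q) =
  trans (cong suc (∣p∣≡∣p∩q∣+∣p─q∣ p q)) (sym (+-suc ∣ p ∩ q ∣ ∣ p ─ q ∣))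

q⊆p⇒p∩q≡q : {p q : Subset n} → q ⊆ p → p ∩ q ≡ q
q⊆p⇒p∩q≡q {p = p} {q} q⊆p = ⊆-antisym (p∩q⊆q p q) (λ x∈q → x∈p∩q⁺ (q⊆p x∈q , x∈q))

q⊆p⇒∣p∣≡∣q∣+∣p─q∣ : {p q : Subset n} → q ⊆ p → ∣ p ∣ ≡ ∣ q ∣ + ∣ p ─ q ∣
q⊆p⇒∣p∣≡∣q∣+∣p─q∣ {p = p} {q} q⊆p =
  trans (∣p∣≡∣p∩q∣+∣p─q∣ p q) (cong (λ r → ∣ r ∣ + ∣ p ─ q ∣) (q⊆p⇒p∩q≡q q⊆p))

⁅x⁆⊆p : ∀ {x} {p : Subset n} → x ∈ p → ⁅ x ⁆ ⊆ p
⁅x⁆⊆p {x = x} x∈p y∈⁅x⁆ = subst (_∈ _) (sym (x∈⁅y⁆⇒x≡y x y∈⁅x⁆)) x∈p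

x∈p⇒∣p∣≡1+∣p-x∣ : ∀ {x} {p : Subset n} → x ∈ p → ∣ p ∣ ≡ suc ∣ p - x ∣
x∈p⇒∣p∣≡1+∣p-x∣ {x = x} {p} x∈p =
  trans (q⊆p⇒∣p∣≡∣q∣+∣p─q∣ (⁅x⁆⊆p x∈p)) (cong (_+ ∣ p - x ∣) (∣⁅x⁆∣≡1 x))

∣p∣≤1+∣p-x∣ : (p : Subset n) (x : Fin n) → ∣ p ∣ ≤ suc ∣ p - x ∣
∣p∣≤1+∣p-x∣ p x = begin
  ∣ p ∣                         ≡⟨ ∣p∣≡∣p∩q∣+∣p─q∣ p ⁅ x ⁆ ⟩
  ∣ p ∩ ⁅ x ⁆ ∣ + ∣ p - x ∣      ≤⟨ +-monoˡ-≤ ∣ p - x ∣ (∣p∩q∣≤∣q∣ p ⁅ x ⁆) ⟩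
  ∣ ⁅ x ⁆ ∣ + ∣ p - x ∣          ≡⟨ cong (_+ ∣ p - x ∣) (∣⁅x⁆∣≡1 x) ⟩
  suc ∣ p - x ∣                 ∎
  where open ≤-Reasoning

Disjoint-mono : {p q p′ q′ : Subset n} → p′ ⊆ p → q′ ⊆ q → Disjoint p q → Disjoint p′ q′
Disjoint-mono p′⊆p q′⊆q p∩q=∅ x∈p′ x∈q′ = p∩q=∅ (p′⊆p x∈p′) (q′⊆q x∈q′)

Disjoint-∪ : {p q p₁ q₁ p₂ q₂ : Subset n} → Disjoint p q →
             p₁ ⊆ p → p₂ ⊆ p → q₁ ⊆ q → q₂ ⊆ q → Disjoint p₁ p₂ → Disjoint q₁ q₂ →
             Disjoint (p₁ ∪ q₁) (p₂ ∪ q₂)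
Disjoint-∪ {p₁ = p₁} {q₁} {p₂} {q₂} p∩q=∅ p₁⊆p p₂⊆p q₁⊆q q₂⊆q p₁∩p₂=∅ q₁∩q₂=∅ x∈₁ x∈₂
  with x∈p∪q⁻ p₁ q₁ x∈₁ | x∈p∪q⁻ p₂ q₂ x∈₂
... | inj₁ x∈p₁ | inj₁ x∈p₂ = p₁∩p₂=∅ x∈p₁ x∈p₂
... | inj₁ x∈p₁ | inj₂ x∈q₂ = p∩q=∅ (p₁⊆p x∈p₁) (q₂⊆q x∈q₂)
... | inj₂ x∈q₁ | inj₁ x∈p₂ = p∩q=∅ (p₂⊆p x∈p₂) (q₁⊆q x∈q₁)
... | inj₂ x∈q₁ | inj₂ x∈q₂ = q₁∩q₂=∅ x∈q₁ x∈q₂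

∪-⊆ : {p q r : Subset n} → p ⊆ r → q ⊆ r → p ∪ q ⊆ r
∪-⊆ {p = p} {q} p⊆r q⊆r x∈p∪q with x∈p∪q⁻ p q x∈p∪q
... | inj₁ x∈p = p⊆r x∈p
... | inj₂ x∈q = q⊆r x∈q

q⊆p⇒q∪[p─q]≡p : {p q : Subset n} → q ⊆ p → q ∪ (p ─ q) ≡ p
q⊆p⇒q∪[p─q]≡p {p = p} {q} q⊆p = ⊆-antisym (∪-⊆ q⊆p (p─q⊆p p q)) p⊆q∪[p─q]
  where
  p⊆q∪[p─q] : p ⊆ q ∪ (p ─ q)
  p⊆q∪[p─q] {x} x∈p with x ∈? q
  ... | yes x∈q = x∈p∪q⁺ (inj₁ x∈q)
  ... | no  x∉q = x∈p∪q⁺ (inj₂ (x∈p∧x∉q⇒x∈p─q x∈p x∉q))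

Nonempty⁺ : (p : Subset n) → 1 ≤ ∣ p ∣ → Nonempty p
Nonempty⁺ {n} p 1≤∣p∣ with nonempty? p
... | yes p≠∅ = p≠∅
... | no  p=∅ = ⊥-elim (1+n≰n (subst (1 ≤_) (trans (cong ∣_∣ (Empty-unique p=∅)) (∣⊥∣≡0 n)) 1≤∣p∣))

Unique⇒length≤∣∣ : {xs : List (Fin n)} {p : Subset n} → Unique xs → All (_∈ p) xs → length xs ≤ ∣ p ∣
Unique⇒length≤∣∣ []                 []             = z≤n
Unique⇒length≤∣∣ {xs = x ∷ xs} {p} (x∉xs ∷ xs!) (x∈p ∷ xs⊆p) = begin
  suc (length xs) ≤⟨ s≤s (Unique⇒length≤∣∣ xs! (All.zipWith in-p-x (x∉xs , xs⊆p))) ⟩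
  suc ∣ p - x ∣   ≡⟨ x∈p⇒∣p∣≡1+∣p-x∣ x∈p ⟨
  ∣ p ∣           ∎
  where
  open ≤-Reasoning
  in-p-x : ∀ {y} → ¬ x ≡ y × y ∈ p → y ∈ p - x
  in-p-x (x≢y , y∈p) = x∈p∧x≢y⇒x∈p-y y∈p (x≢y ∘ sym)

indicator : Subset n → Fin n → ℕ
indicator p x = if does (x ∈? p) then 1 else 0

1≤indicator : ∀ {x} {p : Subset n} → x ∈ p → 1 ≤ indicator p x
1≤indicator {x = x} {p} x∈p with x ∈? p
... | yes _   = s≤s z≤n
... | no  x∉p = ⊥-elim (x∉p x∈p)

sum-indicator≡length-filter : (p : Subset n) (xs : List (Fin n)) →
                              sum (map (indicator p) xs) ≡ length (filter (_∈? p) xs)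
sum-indicator≡length-filter p []       = refl
sum-indicator≡length-filter p (x ∷ xs) with x ∈? p
... | yes _ = cong suc (sum-indicator≡length-filter p xs)
... | no  _ = sum-indicator≡length-filter p xs

Unique⇒sum-indicator≤∣∣ : {xs : List (Fin n)} (p : Subset n) → Unique xs → sum (map (indicator p) xs) ≤ ∣ p ∣
Unique⇒sum-indicator≤∣∣ {xs = xs} p xs! = begin
  sum (map (indicator p) xs)   ≡⟨ sum-indicator≡length-filter p xs ⟩
  length (filter (_∈? p) xs)  ≤⟨ Unique⇒length≤∣∣ (Unique.filter⁺ (_∈? p) xs!) (All.all-filter (_∈? p) xs) ⟩
  ∣ p ∣                       ∎
  where open ≤-Reasoning

sum-map-+ : {A : Set} (f g : A → ℕ) (xs : List A) →
            sum (map (λ x → f x + g x) xs) ≡ sum (map f xs) + sum (map g xs)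
sum-map-+ f g []       = refl
sum-map-+ f g (x ∷ xs) =
  trans (cong (f x + g x +_) (sum-map-+ f g xs)) (interchange (f x) (g x) (sum (map f xs)) (sum (map g xs)))

module _ (G : Graph n) where

  private
    adjacent? : (X : Subset n) (v : Fin n) → Dec (∃ λ u → u ∈ X × adj G u v ≡ true)
    adjacent? X v = any? λ u → (u ∈? X) ×-dec (adj G u v ≟ᵇ true)

    witness : {A : Set} (a? : Dec A) → does a? ≡ true → A
    witness (yes a) _ = a

  ∈N⁺ : ∀ {X u v} → u ∈ X → adj G u v ≡ true → v ∈ N G X
  ∈N⁺ {X} {u} {v} u∈X uv =
    lookup⇒[]= v (N G X) (trans (lookup∘tabulate _ v) (dec-true (adjacent? X v) (u , u∈X , uv)))

  ∈N⁻ : ∀ {X v} → v ∈ N G X → ∃ λ u → u ∈ X × adj G u v ≡ true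
  ∈N⁻ {X} {v} v∈NX = witness (adjacent? X v) (trans (sym (lookup∘tabulate _ v)) ([]=⇒lookup v∈NX))

  ∈N⁅u⁆⁻ : ∀ {u v} → v ∈ N G ⁅ u ⁆ → adj G u v ≡ true
  ∈N⁅u⁆⁻ {u} v∈N⁅u⁆ with ∈N⁻ v∈N⁅u⁆
  ... | w , w∈⁅u⁆ , wv rewrite x∈⁅y⁆⇒x≡y u w∈⁅u⁆ = wv

  N-mono : ∀ {X Y} → X ⊆ Y → N G X ⊆ N G Y
  N-mono X⊆Y v∈NX with ∈N⁻ v∈NX
  ... | u , u∈X , uv = ∈N⁺ (X⊆Y u∈X) uv

  N-∪ : ∀ X Y → N G (X ∪ Y) ⊆ N G X ∪ N G Y
  N-∪ X Y v∈N[X∪Y] with ∈N⁻ v∈N[X∪Y]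
  ... | u , u∈X∪Y , uv with x∈p∪q⁻ X Y u∈X∪Y
  ...   | inj₁ u∈X = x∈p∪q⁺ (inj₁ (∈N⁺ u∈X uv))
  ...   | inj₂ u∈Y = x∈p∪q⁺ (inj₂ (∈N⁺ u∈Y uv))

  N-∩ : ∀ X Y → N G (X ∩ Y) ⊆ N G X ∩ N G Y
  N-∩ X Y v∈N[X∩Y] = x∈p∩q⁺ (N-mono (p∩q⊆p X Y) v∈N[X∩Y] , N-mono (p∩q⊆q X Y) v∈N[X∩Y])

  ∣N∪∣+∣N∩∣≤∣N∣+∣N∣ : ∀ X Y → ∣ N G (X ∪ Y) ∣ + ∣ N G (X ∩ Y) ∣ ≤ ∣ N G X ∣ + ∣ N G Y ∣
  ∣N∪∣+∣N∩∣≤∣N∣+∣N∣ X Y = begin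
    ∣ N G (X ∪ Y) ∣ + ∣ N G (X ∩ Y) ∣             ≤⟨ +-mono-≤ (p⊆q⇒∣p∣≤∣q∣ (N-∪ X Y)) (p⊆q⇒∣p∣≤∣q∣ (N-∩ X Y)) ⟩
    ∣ N G X ∪ N G Y ∣ + ∣ N G X ∩ N G Y ∣         ≡⟨ ∣p∪q∣+∣p∩q∣≡∣p∣+∣q∣ (N G X) (N G Y) ⟩
    ∣ N G X ∣ + ∣ N G Y ∣                         ∎
    where open ≤-Reasoning

  Critical′ : Subset n → Set
  Critical′ X = ∀ Y → ∣ Y ∣ + ∣ N G X ∣ ≤ ∣ X ∣ + ∣ N G Y ∣

  Critical⇔Critical′ : ∀ X → Critical G X ⇔ Critical′ X
  Critical⇔Critical′ X = mk⇔
    (λ X-critical Y → Equivalence.to (d≤d⇔ Y) (X-critical Y))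
    (λ X-critical Y → Equivalence.from (d≤d⇔ Y) (X-critical Y))
    where
    d≤d⇔ : ∀ Y → (d G Y ℤ.≤ d G X) ⇔ (∣ Y ∣ + ∣ N G X ∣ ≤ ∣ X ∣ + ∣ N G Y ∣)
    d≤d⇔ Y = m-n≤o-p⇔m+p≤o+n (∣ Y ∣) (∣ N G Y ∣) (∣ X ∣) (∣ N G X ∣)

  -- Supermodularity d(X ∪ Y) + d(X ∩ Y) ≥ d(X) + d(Y), combined with d(X ∩ Y) ≤ d(Y).
  Critical′-∪ : ∀ {X Y} → Critical′ X → Critical′ Y → Critical′ (X ∪ Y)
  Critical′-∪ {X} {Y} X-critical Y-critical Z =
    +-cancelʳ-≤ (∣ X ∩ Y ∣ + ∣ N G (X ∩ Y) ∣) (∣ Z ∣ + ∣ N G (X ∪ Y) ∣) (∣ X ∪ Y ∣ + ∣ N G Z ∣) (begin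
      (∣ Z ∣ + ∣ N G (X ∪ Y) ∣) + (∣ X ∩ Y ∣ + ∣ N G (X ∩ Y) ∣)
        ≡⟨ interchange ∣ Z ∣ _ _ _ ⟩
      (∣ Z ∣ + ∣ X ∩ Y ∣) + (∣ N G (X ∪ Y) ∣ + ∣ N G (X ∩ Y) ∣)
        ≤⟨ +-monoʳ-≤ (∣ Z ∣ + ∣ X ∩ Y ∣) (∣N∪∣+∣N∩∣≤∣N∣+∣N∣ X Y) ⟩
      (∣ Z ∣ + ∣ X ∩ Y ∣) + (∣ N G X ∣ + ∣ N G Y ∣)
        ≡⟨ interchange ∣ Z ∣ _ _ _ ⟩
      (∣ Z ∣ + ∣ N G X ∣) + (∣ X ∩ Y ∣ + ∣ N G Y ∣)
        ≤⟨ +-mono-≤ (X-critical Z) (Y-critical (X ∩ Y)) ⟩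
      (∣ X ∣ + ∣ N G Z ∣) + (∣ Y ∣ + ∣ N G (X ∩ Y) ∣)
        ≡⟨ interchange ∣ X ∣ _ _ _ ⟩
      (∣ X ∣ + ∣ Y ∣) + (∣ N G Z ∣ + ∣ N G (X ∩ Y) ∣)
        ≡⟨ cong (_+ (∣ N G Z ∣ + ∣ N G (X ∩ Y) ∣)) (∣p∪q∣+∣p∩q∣≡∣p∣+∣q∣ X Y) ⟨
      (∣ X ∪ Y ∣ + ∣ X ∩ Y ∣) + (∣ N G Z ∣ + ∣ N G (X ∩ Y) ∣)
        ≡⟨ interchange ∣ X ∪ Y ∣ _ _ _ ⟩
      (∣ X ∪ Y ∣ + ∣ N G Z ∣) + (∣ X ∩ Y ∣ + ∣ N G (X ∩ Y) ∣) ∎)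
    where open ≤-Reasoning

  Critical′-⋃ : ∀ X Xs → All Critical′ (X ∷ Xs) → Critical′ (⋃ (X ∷ Xs))
  Critical′-⋃ X []       (X-critical ∷ [])  rewrite ∪-identityʳ X = X-critical
  Critical′-⋃ X (Y ∷ Xs) (X-critical ∷ Xs-critical) =
    Critical′-∪ X-critical (Critical′-⋃ Y Xs Xs-critical)

  Independent⇒v∉S : ∀ {S u v} → Independent G S → adj G u v ≡ true → u ∈ S → v ∉ S
  Independent⇒v∉S S-independent uv u∈S v∈S with trans (sym uv) (S-independent _ _ u∈S v∈S)
  ... | ()

  Edges : List (Fin n × Fin n) → Set
  Edges = All (λ (a , b) → adj G a b ≡ true)

  Edges⇒k*∣M∣≤weight : ∀ {k} (w : Fin n → ℕ) → (∀ {a b} → adj G a b ≡ true → k ≤ w a + w b) →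
                       ∀ {M} → Edges M → k * length M ≤ sum (map w (endpoints G M))
  Edges⇒k*∣M∣≤weight {k} w k≤w[e] {[]} [] = ≤-reflexive (*-zeroʳ k)
  Edges⇒k*∣M∣≤weight {k} w k≤w[e] {(a , b) ∷ M} (ab ∷ M-edges) = begin
    k * suc (length M)                         ≡⟨ *-suc k (length M) ⟩
    k + k * length M                           ≤⟨ +-mono-≤ (k≤w[e] ab) (Edges⇒k*∣M∣≤weight w k≤w[e] M-edges) ⟩
    (w a + w b) + sum (map w (endpoints G M))  ≡⟨ +-assoc (w a) (w b) _ ⟩
    sum (map w (endpoints G ((a , b) ∷ M)))    ∎
    where open ≤-Reasoning

  Independent⇒∣M∣≤∣∁S∣ : ∀ {S M} → Independent G S → Matching G M → length M ≤ ∣ ∁ S ∣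
  Independent⇒∣M∣≤∣∁S∣ {S} {M} S-independent (M-edges , M!) = begin
    length M                                       ≡⟨ *-identityˡ (length M) ⟨
    1 * length M                                   ≤⟨ Edges⇒k*∣M∣≤weight (indicator (∁ S)) edge-leaves-S M-edges ⟩
    sum (map (indicator (∁ S)) (endpoints G M))    ≤⟨ Unique⇒sum-indicator≤∣∣ (∁ S) M! ⟩
    ∣ ∁ S ∣                                         ∎
    where
    open ≤-Reasoning
    edge-leaves-S : ∀ {a b} → adj G a b ≡ true → 1 ≤ indicator (∁ S) a + indicator (∁ S) b
    edge-leaves-S {a} {b} ab with a ∈? S | b ∈? S
    ... | yes a∈S | yes b∈S = ⊥-elim (Independent⇒v∉S S-independent ab a∈S b∈S)
    ... | no  a∉S | _       = ≤-trans (1≤indicator (x∉p⇒x∈∁p a∉S)) (m≤m+n _ _)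
    ... | yes _   | no  b∉S = ≤-trans (1≤indicator (x∉p⇒x∈∁p b∉S)) (m≤n+m _ _)

  ∣Y∣+2∣M∣≤n+∣NY∣ : ∀ Y {M} → Matching G M → ∣ Y ∣ + 2 * length M ≤ n + ∣ N G Y ∣
  ∣Y∣+2∣M∣≤n+∣NY∣ Y {M} (M-edges , M!) = begin
    ∣ Y ∣ + 2 * length M          ≤⟨ +-monoʳ-≤ ∣ Y ∣ 2∣M∣≤∣∁Y∣+∣NY∣ ⟩
    ∣ Y ∣ + (∣ ∁ Y ∣ + ∣ N G Y ∣)   ≡⟨ +-assoc (∣ Y ∣) (∣ ∁ Y ∣) (∣ N G Y ∣) ⟨
    ∣ Y ∣ + ∣ ∁ Y ∣ + ∣ N G Y ∣     ≡⟨ cong (_+ ∣ N G Y ∣) (∣p∣+∣∁p∣≡n Y) ⟩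
    n + ∣ N G Y ∣                 ∎
    where
    open ≤-Reasoning
    w : Fin n → ℕ
    w x = indicator (∁ Y) x + indicator (N G Y) x
    1≤w : ∀ {x} → x ∉ Y ⊎ x ∈ N G Y → 1 ≤ w x
    1≤w (inj₁ x∉Y)  = ≤-trans (1≤indicator (x∉p⇒x∈∁p x∉Y)) (m≤m+n _ _)
    1≤w (inj₂ x∈NY) = ≤-trans (1≤indicator x∈NY) (m≤n+m _ _)
    2≤w : ∀ {x} → x ∉ Y → x ∈ N G Y → 2 ≤ w x
    2≤w x∉Y x∈NY = +-mono-≤ (1≤indicator (x∉p⇒x∈∁p x∉Y)) (1≤indicator x∈NY)
    edge-weight : ∀ {a b} → adj G a b ≡ true → 2 ≤ w a + w b
    edge-weight {a} {b} ab with a ∈? Y | b ∈? Y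
    ... | yes a∈Y | yes b∈Y = +-mono-≤ (1≤w (inj₂ (∈N⁺ b∈Y ba))) (1≤w (inj₂ (∈N⁺ a∈Y ab)))
      where ba = trans (Graph.sym G b a) ab
    ... | yes a∈Y | no  b∉Y = ≤-trans (2≤w b∉Y (∈N⁺ a∈Y ab)) (m≤n+m (w b) (w a))
    ... | no  a∉Y | yes b∈Y = ≤-trans (2≤w a∉Y (∈N⁺ b∈Y ba)) (m≤m+n (w a) (w b))
      where ba = trans (Graph.sym G b a) ab
    ... | no  a∉Y | no  b∉Y = +-mono-≤ (1≤w (inj₁ a∉Y)) (1≤w (inj₁ b∉Y))
    E : List (Fin n)
    E = endpoints G M
    2∣M∣≤∣∁Y∣+∣NY∣ : 2 * length M ≤ ∣ ∁ Y ∣ + ∣ N G Y ∣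
    2∣M∣≤∣∁Y∣+∣NY∣ = begin
      2 * length M
        ≤⟨ Edges⇒k*∣M∣≤weight w edge-weight M-edges ⟩
      sum (map w E)
        ≡⟨ sum-map-+ (indicator (∁ Y)) (indicator (N G Y)) E ⟩
      sum (map (indicator (∁ Y)) E) + sum (map (indicator (N G Y)) E)
        ≤⟨ +-mono-≤ (Unique⇒sum-indicator≤∣∣ (∁ Y) M!) (Unique⇒sum-indicator≤∣∣ (N G Y) M!) ⟩
      ∣ ∁ Y ∣ + ∣ N G Y ∣ ∎

  MaxIndependent⇒v∈NS : ∀ {S v} → MaxIndependent G S → v ∉ S → v ∈ N G S
  MaxIndependent⇒v∈NS {S} {v} (S-independent , S-maximum) v∉S with v ∈? N G S
  ... | yes v∈NS = v∈NS
  ... | no  v∉NS = ⊥-elim (1+n≰n (begin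
    suc ∣ S ∣          ≡⟨ +-comm 1 ∣ S ∣ ⟩
    ∣ S ∣ + 1          ≡⟨ cong (∣ S ∣ +_) (∣⁅x⁆∣≡1 v) ⟨
    ∣ S ∣ + ∣ ⁅ v ⁆ ∣    ≡⟨ Disjoint⇒∣p∪q∣≡∣p∣+∣q∣ v∉S∩⁅v⁆ ⟨
    ∣ S ∪ ⁅ v ⁆ ∣       ≤⟨ S-maximum (S ∪ ⁅ v ⁆) S∪⁅v⁆-independent ⟩
    ∣ S ∣              ∎))
    where
    open ≤-Reasoning
    v∉S∩⁅v⁆ : Disjoint S ⁅ v ⁆
    v∉S∩⁅v⁆ u∈S u∈⁅v⁆ = v∉S (subst (_∈ S) (x∈⁅y⁆⇒x≡y v u∈⁅v⁆) u∈S)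
    no-edge : ∀ {u} → u ∈ S → adj G u v ≡ false
    no-edge u∈S = ¬-not λ uv → v∉NS (∈N⁺ u∈S uv)
    S∪⁅v⁆-independent : Independent G (S ∪ ⁅ v ⁆)
    S∪⁅v⁆-independent u w u∈ w∈ with x∈p∪q⁻ S ⁅ v ⁆ u∈ | x∈p∪q⁻ S ⁅ v ⁆ w∈
    ... | inj₁ u∈S   | inj₁ w∈S   = S-independent u w u∈S w∈S
    ... | inj₁ u∈S   | inj₂ w∈⁅v⁆ rewrite x∈⁅y⁆⇒x≡y v w∈⁅v⁆ = no-edge u∈S
    ... | inj₂ u∈⁅v⁆ | inj₁ w∈S   rewrite x∈⁅y⁆⇒x≡y v u∈⁅v⁆ = trans (Graph.sym G v w) (no-edge w∈S)
    ... | inj₂ u∈⁅v⁆ | inj₂ w∈⁅v⁆ rewrite x∈⁅y⁆⇒x≡y v u∈⁅v⁆ | x∈⁅y⁆⇒x≡y v w∈⁅v⁆ = Graph.irrefl G v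

  v∈N⋃⇒v∉⋂ : ∀ {Λ v} → All (Independent G) Λ → v ∈ N G (⋃ Λ) → v ∉ ⋂ Λ
  v∈N⋃⇒v∉⋂ [] v∈N⊥ _ = ∉⊥ (proj₁ (proj₂ (∈N⁻ v∈N⊥)))
  v∈N⋃⇒v∉⋂ {S ∷ Λ} (S-independent ∷ Λ-independent) v∈N⋃ v∈⋂
    with x∈p∪q⁻ (N G S) (N G (⋃ Λ)) (N-∪ S (⋃ Λ) v∈N⋃) | x∈p∩q⁻ S (⋂ Λ) v∈⋂
  ... | inj₁ v∈NS  | v∈S , _  = let u , u∈S , uv = ∈N⁻ v∈NS in Independent⇒v∉S S-independent uv u∈S v∈S
  ... | inj₂ v∈N⋃′ | _ , v∈⋂′ = v∈N⋃⇒v∉⋂ Λ-independent v∈N⋃′ v∈⋂′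

  v∉⋂⇒v∈N⋃ : ∀ {Λ v} → All (MaxIndependent G) Λ → v ∉ ⋂ Λ → v ∈ N G (⋃ Λ)
  v∉⋂⇒v∈N⋃ []                            v∉⊤ = ⊥-elim (v∉⊤ ∈⊤)
  v∉⋂⇒v∈N⋃ {S ∷ Λ} {v} (S-max ∷ Λ-max) v∉⋂ with v ∈? S
  ... | no  v∉S = N-mono (p⊆p∪q (⋃ Λ)) (MaxIndependent⇒v∈NS S-max v∉S)
  ... | yes v∈S = N-mono (q⊆p∪q S (⋃ Λ)) (v∉⋂⇒v∈N⋃ Λ-max λ v∈⋂′ → v∉⋂ (x∈p∩q⁺ (v∈S , v∈⋂′)))

  N⋃≡∁⋂ : ∀ {Λ} → All (MaxIndependent G) Λ → N G (⋃ Λ) ≡ ∁ (⋂ Λ)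
  N⋃≡∁⋂ Λ-max = ⊆-antisym
    (λ v∈N⋃ → x∉p⇒x∈∁p (v∈N⋃⇒v∉⋂ (All.map proj₁ Λ-max) v∈N⋃))
    (λ v∈∁⋂ → v∉⋂⇒v∈N⋃ Λ-max (x∈∁p⇒x∉p v∈∁⋂))

  ∣⋂∣+∣N⋃∣≡n : ∀ {Λ} → All (MaxIndependent G) Λ → ∣ ⋂ Λ ∣ + ∣ N G (⋃ Λ) ∣ ≡ n
  ∣⋂∣+∣N⋃∣≡n {Λ} Λ-max = trans (cong (λ X → ∣ ⋂ Λ ∣ + ∣ X ∣) (N⋃≡∁⋂ Λ-max)) (∣p∣+∣∁p∣≡n (⋂ Λ))

  ∣S∣+∣NS∣≡n : ∀ {S} → MaxIndependent G S → ∣ S ∣ + ∣ N G S ∣ ≡ n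
  ∣S∣+∣NS∣≡n {S} S-max =
    subst₂ (λ X Y → ∣ Y ∣ + ∣ N G X ∣ ≡ n) (∪-identityʳ S) (∩-identityʳ S) (∣⋂∣+∣N⋃∣≡n (S-max ∷ []))

  Between : Subset n → Subset n → List (Fin n × Fin n) → Set
  Between L R = All (λ (a , b) → a ∈ L × b ∈ R)

  HallCondition : Subset n → Subset n → Set
  HallCondition L R = ∀ A → A ⊆ L → ∣ A ∣ ≤ ∣ N G A ∩ R ∣

  SaturatingMatching : Subset n → Subset n → Set
  SaturatingMatching L R = Σ (List (Fin n × Fin n)) λ M → Matching G M × Between L R M × length M ≡ ∣ L ∣

  endpoints-++ : ∀ M₁ M₂ → endpoints G (M₁ ++ M₂) ≡ endpoints G M₁ ++ endpoints G M₂
  endpoints-++ []             M₂ = refl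
  endpoints-++ ((a , b) ∷ M₁) M₂ = cong (λ xs → a ∷ b ∷ xs) (endpoints-++ M₁ M₂)

  Between⇒endpoints∈ : ∀ {L R M} → Between L R M → All (_∈ L ∪ R) (endpoints G M)
  Between⇒endpoints∈ []                       = []
  Between⇒endpoints∈ ((a∈L , b∈R) ∷ between) =
    x∈p∪q⁺ (inj₁ a∈L) ∷ x∈p∪q⁺ (inj₂ b∈R) ∷ Between⇒endpoints∈ between

  SaturatingMatching-∅ : ∀ {L R} → Empty L → SaturatingMatching L R
  SaturatingMatching-∅ L=∅ = [] , ([] , []) , [] , sym (trans (cong ∣_∣ (Empty-unique L=∅)) (∣⊥∣≡0 n))

  SaturatingMatching-edge : ∀ {a b} → adj G a b ≡ true → SaturatingMatching ⁅ a ⁆ ⁅ b ⁆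
  SaturatingMatching-edge {a} {b} ab =
    (a , b) ∷ [] , (ab ∷ [] , (a≢b ∷ []) ∷ [] ∷ []) , (x∈⁅x⁆ a , x∈⁅x⁆ b) ∷ [] , sym (∣⁅x⁆∣≡1 a)
    where
    a≢b : ¬ a ≡ b
    a≢b refl with trans (sym ab) (Graph.irrefl G a)
    ... | ()

  SaturatingMatching-∪ : ∀ {L₁ R₁ L₂ R₂} → Disjoint (L₁ ∪ R₁) (L₂ ∪ R₂) →
                         SaturatingMatching L₁ R₁ → SaturatingMatching L₂ R₂ →
                         SaturatingMatching (L₁ ∪ L₂) (R₁ ∪ R₂)
  SaturatingMatching-∪ {L₁} {R₁} {L₂} {R₂} disjoint
    (M₁ , (M₁-edges , M₁!) , M₁-between , ∣M₁∣≡∣L₁∣) (M₂ , (M₂-edges , M₂!) , M₂-between , ∣M₂∣≡∣L₂∣) =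
    M₁ ++ M₂ ,
    (All.++⁺ M₁-edges M₂-edges , subst Unique (sym (endpoints-++ M₁ M₂)) (Unique.++⁺ M₁! M₂! endpoints-disjoint)) ,
    All.++⁺ (All.map (Product.map (p⊆p∪q L₂) (p⊆p∪q R₂)) M₁-between)
            (All.map (Product.map (q⊆p∪q L₁ L₂) (q⊆p∪q R₁ R₂)) M₂-between) ,
    (begin
      length (M₁ ++ M₂)     ≡⟨ length-++ M₁ ⟩
      length M₁ + length M₂ ≡⟨ cong₂ _+_ ∣M₁∣≡∣L₁∣ ∣M₂∣≡∣L₂∣ ⟩
      ∣ L₁ ∣ + ∣ L₂ ∣         ≡⟨ Disjoint⇒∣p∪q∣≡∣p∣+∣q∣ (Disjoint-mono (p⊆p∪q R₁) (p⊆p∪q R₂) disjoint) ⟨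
      ∣ L₁ ∪ L₂ ∣            ∎)
    where
    open ≡-Reasoning
    endpoints-disjoint : ∀ {v} → ¬ (v ∈ˡ endpoints G M₁ × v ∈ˡ endpoints G M₂)
    endpoints-disjoint (v∈E₁ , v∈E₂) =
      disjoint (All.lookup (Between⇒endpoints∈ M₁-between) v∈E₁) (All.lookup (Between⇒endpoints∈ M₂-between) v∈E₂)

  SaturatingMatching-widen : ∀ {L R R′} → R ⊆ R′ → SaturatingMatching L R → SaturatingMatching L R′
  SaturatingMatching-widen R⊆R′ (M , matching , between , ∣M∣≡∣L∣) =
    M , matching , All.map (Product.map₂ R⊆R′) between , ∣M∣≡∣L∣

  HallCondition-inner : ∀ {L R A} → HallCondition L R → A ⊆ L → HallCondition A (N G A ∩ R)
  HallCondition-inner {L} {R} {A} hall A⊆L B B⊆A = ≤-trans (hall B (⊆-trans B⊆A A⊆L)) (p⊆q⇒∣p∣≤∣q∣ NB∩R⊆NB∩NA∩R)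
    where
    NB∩R⊆NB∩NA∩R : N G B ∩ R ⊆ N G B ∩ (N G A ∩ R)
    NB∩R⊆NB∩NA∩R x∈ with x∈p∩q⁻ (N G B) R x∈
    ... | x∈NB , x∈R = x∈p∩q⁺ (x∈NB , x∈p∩q⁺ (N-mono B⊆A x∈NB , x∈R))

  HallCondition-outer : ∀ {L R A} → HallCondition L R → A ⊆ L → ∣ N G A ∩ R ∣ ≤ ∣ A ∣ →
                        HallCondition (L ─ A) (R ─ N G A)
  HallCondition-outer {L} {R} {A} hall A⊆L A-tight B B⊆L─A =
    +-cancelˡ-≤ (∣ A ∣) (∣ B ∣) (∣ N G B ∩ (R ─ N G A) ∣) (begin
      ∣ A ∣ + ∣ B ∣                               ≡⟨ Disjoint⇒∣p∪q∣≡∣p∣+∣q∣ A∩B=∅ ⟨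
      ∣ A ∪ B ∣                                   ≤⟨ hall (A ∪ B) (∪-⊆ A⊆L (⊆-trans B⊆L─A (p─q⊆p L A))) ⟩
      ∣ N G (A ∪ B) ∩ R ∣                         ≤⟨ p⊆q⇒∣p∣≤∣q∣ N[A∪B]∩R⊆ ⟩
      ∣ (N G A ∩ R) ∪ (N G B ∩ (R ─ N G A)) ∣     ≤⟨ ∣p∪q∣≤∣p∣+∣q∣ (N G A ∩ R) (N G B ∩ (R ─ N G A)) ⟩
      ∣ N G A ∩ R ∣ + ∣ N G B ∩ (R ─ N G A) ∣     ≤⟨ +-monoˡ-≤ ∣ N G B ∩ (R ─ N G A) ∣ A-tight ⟩
      ∣ A ∣ + ∣ N G B ∩ (R ─ N G A) ∣             ∎)
    where
    open ≤-Reasoning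
    A∩B=∅ : Disjoint A B
    A∩B=∅ = Disjoint-mono ⊆-refl B⊆L─A (q⊆r⇒Disjoint[q,p─r] ⊆-refl)
    N[A∪B]∩R⊆ : N G (A ∪ B) ∩ R ⊆ (N G A ∩ R) ∪ (N G B ∩ (R ─ N G A))
    N[A∪B]∩R⊆ {x} x∈ with x∈p∩q⁻ (N G (A ∪ B)) R x∈
    ... | x∈N[A∪B] , x∈R with x ∈? N G A | x∈p∪q⁻ (N G A) (N G B) (N-∪ A B x∈N[A∪B])
    ...   | yes x∈NA | _         = x∈p∪q⁺ (inj₁ (x∈p∩q⁺ (x∈NA , x∈R)))
    ...   | no  x∉NA | inj₁ x∈NA = ⊥-elim (x∉NA x∈NA)
    ...   | no  x∉NA | inj₂ x∈NB = x∈p∪q⁺ (inj₂ (x∈p∩q⁺ (x∈NB , x∈p∧x∉q⇒x∈p─q x∈R x∉NA)))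

  Tight : Subset n → Subset n → Subset n → Set
  Tight L R A = A ⊆ L × 1 ≤ ∣ A ∣ × ∣ A ∣ < ∣ L ∣ × ∣ N G A ∩ R ∣ ≤ ∣ A ∣

  HallCondition-edge : ∀ {L R a b} → HallCondition L R → (∀ A → ¬ Tight L R A) → a ∈ L →
                       HallCondition (L - a) (R - b)
  HallCondition-edge {L} {R} {a} {b} hall no-tight a∈L B B⊆L-a with 1 ≤? ∣ B ∣
  ... | no  B=∅ = ≤-trans (s≤s⁻¹ (≰⇒> B=∅)) z≤n
  ... | yes 1≤∣B∣ = s≤s⁻¹ (begin-strict
    ∣ B ∣                  <⟨ ≰⇒> (λ B-tight → no-tight B (B⊆L , 1≤∣B∣ , ∣B∣<∣L∣ , B-tight)) ⟩
    ∣ N G B ∩ R ∣          ≤⟨ ∣p∣≤1+∣p-x∣ (N G B ∩ R) b ⟩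
    suc ∣ N G B ∩ R - b ∣  ≤⟨ s≤s (p⊆q⇒∣p∣≤∣q∣ NB∩R-b⊆) ⟩
    suc ∣ N G B ∩ (R - b) ∣ ∎)
    where
    open ≤-Reasoning
    B⊆L : B ⊆ L
    B⊆L = ⊆-trans B⊆L-a (p─q⊆p L ⁅ a ⁆)
    ∣B∣<∣L∣ : ∣ B ∣ < ∣ L ∣
    ∣B∣<∣L∣ = ≤-<-trans (p⊆q⇒∣p∣≤∣q∣ B⊆L-a) (x∈p⇒∣p-x∣<∣p∣ a∈L)
    NB∩R-b⊆ : N G B ∩ R - b ⊆ N G B ∩ (R - b)
    NB∩R-b⊆ x∈ with x∈p─q⁻ (N G B ∩ R) ⁅ b ⁆ x∈
    ... | x∈NB∩R , x∉⁅b⁆ with x∈p∩q⁻ (N G B) R x∈NB∩R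
    ...   | x∈NB , x∈R = x∈p∩q⁺ (x∈NB , x∈p∧x∉q⇒x∈p─q x∈R x∉⁅b⁆)

  tight? : ∀ L R A → Dec (Tight L R A)
  tight? L R A = (A ⊆? L) ×-dec (1 ≤? ∣ A ∣) ×-dec (suc ∣ A ∣ ≤? ∣ L ∣) ×-dec (∣ N G A ∩ R ∣ ≤? ∣ A ∣)

  HallBelow : ℕ → Set
  HallBelow k = ∀ {L R} → ∣ L ∣ ≤ k → Disjoint L R → HallCondition L R → SaturatingMatching L R

  hall-tight : ∀ {k L R A} → HallBelow k → ∣ L ∣ ≤ suc k → Disjoint L R → HallCondition L R →
               Tight L R A → SaturatingMatching L R
  hall-tight {k} {L} {R} {A} hall-below ∣L∣≤1+k L∩R=∅ hall (A⊆L , 1≤∣A∣ , ∣A∣<∣L∣ , A-tight) =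
    subst (λ L → SaturatingMatching L R) (q⊆p⇒q∪[p─q]≡p A⊆L)
      (SaturatingMatching-widen (∪-⊆ (p∩q⊆q (N G A) R) (p─q⊆p R (N G A)))
        (SaturatingMatching-∪ disjoint
          (hall-below ∣A∣≤k (Disjoint-mono ⊆-refl (p∩q⊆q (N G A) R) A∩R=∅) (HallCondition-inner hall A⊆L))
          (hall-below ∣L─A∣≤k (Disjoint-mono (p─q⊆p L A) (p─q⊆p R (N G A)) L∩R=∅)
                      (HallCondition-outer hall A⊆L A-tight))))
    where
    A∩R=∅ : Disjoint A R
    A∩R=∅ = Disjoint-mono A⊆L ⊆-refl L∩R=∅
    disjoint : Disjoint (A ∪ (N G A ∩ R)) ((L ─ A) ∪ (R ─ N G A))
    disjoint = Disjoint-∪ L∩R=∅ A⊆L (p─q⊆p L A) (p∩q⊆q (N G A) R) (p─q⊆p R (N G A))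
                 (q⊆r⇒Disjoint[q,p─r] ⊆-refl) (q⊆r⇒Disjoint[q,p─r] (p∩q⊆p (N G A) R))
    ∣A∣≤k : ∣ A ∣ ≤ k
    ∣A∣≤k = s≤s⁻¹ (≤-trans ∣A∣<∣L∣ ∣L∣≤1+k)
    ∣L─A∣≤k : ∣ L ─ A ∣ ≤ k
    ∣L─A∣≤k = s≤s⁻¹ (begin
      suc ∣ L ─ A ∣     ≤⟨ +-monoˡ-≤ ∣ L ─ A ∣ 1≤∣A∣ ⟩
      ∣ A ∣ + ∣ L ─ A ∣  ≡⟨ q⊆p⇒∣p∣≡∣q∣+∣p─q∣ A⊆L ⟨
      ∣ L ∣             ≤⟨ ∣L∣≤1+k ⟩
      suc k             ∎)
      where open ≤-Reasoning

  hall-edge : ∀ {k L R a} → HallBelow k → ∣ L ∣ ≤ suc k → Disjoint L R → HallCondition L R →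
              (∀ A → ¬ Tight L R A) → a ∈ L → SaturatingMatching L R
  hall-edge {k} {L} {R} {a} hall-below ∣L∣≤1+k L∩R=∅ hall no-tight a∈L
    with Nonempty⁺ (N G ⁅ a ⁆ ∩ R) (subst (_≤ ∣ N G ⁅ a ⁆ ∩ R ∣) (∣⁅x⁆∣≡1 a) (hall ⁅ a ⁆ (⁅x⁆⊆p a∈L)))
  ... | b , b∈N⁅a⁆∩R with x∈p∩q⁻ (N G ⁅ a ⁆) R b∈N⁅a⁆∩R
  ...   | b∈N⁅a⁆ , b∈R =
    subst (λ L → SaturatingMatching L R) (q⊆p⇒q∪[p─q]≡p (⁅x⁆⊆p a∈L))
      (SaturatingMatching-widen (∪-⊆ (⁅x⁆⊆p b∈R) (p─q⊆p R ⁅ b ⁆))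
        (SaturatingMatching-∪ disjoint
          (SaturatingMatching-edge (∈N⁅u⁆⁻ b∈N⁅a⁆))
          (hall-below ∣L-a∣≤k (Disjoint-mono (p─q⊆p L ⁅ a ⁆) (p─q⊆p R ⁅ b ⁆) L∩R=∅)
                      (HallCondition-edge hall no-tight a∈L))))
    where
    disjoint : Disjoint (⁅ a ⁆ ∪ ⁅ b ⁆) ((L - a) ∪ (R - b))
    disjoint = Disjoint-∪ L∩R=∅ (⁅x⁆⊆p a∈L) (p─q⊆p L ⁅ a ⁆) (⁅x⁆⊆p b∈R) (p─q⊆p R ⁅ b ⁆)
                 (q⊆r⇒Disjoint[q,p─r] ⊆-refl) (q⊆r⇒Disjoint[q,p─r] ⊆-refl)
    ∣L-a∣≤k : ∣ L - a ∣ ≤ k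
    ∣L-a∣≤k = s≤s⁻¹ (≤-trans (x∈p⇒∣p-x∣<∣p∣ a∈L) ∣L∣≤1+k)

  -- Halmos–Vaughan induction: split L at a tight proper subset if there is one; otherwise
  -- match any vertex of L to any of its neighbours in R and recurse on what is left.
  hall-below : ∀ k → HallBelow k
  hall-below k {L} {R} ∣L∣≤k L∩R=∅ hall with nonempty? L
  ... | no  L=∅ = SaturatingMatching-∅ L=∅
  ... | yes (a , a∈L) with k | anySubset? (tight? L R)
  ...   | zero  | _              = ⊥-elim (<⇒≱ (x∈p⇒∣p-x∣<∣p∣ a∈L) (≤-trans ∣L∣≤k z≤n))
  ...   | suc k | yes (A , tight) = hall-tight (hall-below k) ∣L∣≤k L∩R=∅ hall tight
  ...   | suc k | no  no-tight    =
    hall-edge (hall-below k) ∣L∣≤k L∩R=∅ hall (λ A tight → no-tight (A , tight)) a∈L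

  hall-theorem : ∀ {L R} → Disjoint L R → HallCondition L R → SaturatingMatching L R
  hall-theorem {L} = hall-below ∣ L ∣ ≤-refl

  IsIndependenceNumber-unique : ∀ {a b} → IsIndependenceNumber G a → IsIndependenceNumber G b → a ≡ b
  IsIndependenceNumber-unique ((S , S-independent , ∣S∣≡a) , a-max) ((T , T-independent , ∣T∣≡b) , b-max) =
    ≤-antisym (subst (_≤ _) ∣S∣≡a (b-max S S-independent)) (subst (_≤ _) ∣T∣≡b (a-max T T-independent))

  MaxIndependent⇒∣S∣≡α : ∀ {α S} → IsIndependenceNumber G α → MaxIndependent G S → ∣ S ∣ ≡ α
  MaxIndependent⇒∣S∣≡α ((S₀ , S₀-independent , ∣S₀∣≡α) , α-max) (S-independent , S-max) =
    ≤-antisym (α-max _ S-independent) (subst (_≤ _) ∣S₀∣≡α (S-max S₀ S₀-independent))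

  DeficiencyBound : ℕ → Set
  DeficiencyBound α = ∀ Y → ∣ Y ∣ + n ≤ 2 * α + ∣ N G Y ∣

  module _ {α : ℕ} (α-is-α : IsIndependenceNumber G α) where

    KonigEgervary⇒DeficiencyBound : KonigEgervary G → DeficiencyBound α
    KonigEgervary⇒DeficiencyBound (a , m , a-is-α , ((M , M-matching , ∣M∣≡m) , _) , a+m≡n) Y =
      +-cancelʳ-≤ m (∣ Y ∣ + n) (2 * α + ∣ N G Y ∣) (begin
        ∣ Y ∣ + n + m          ≡⟨ cong (λ k → ∣ Y ∣ + k + m) α+m≡n ⟨
        ∣ Y ∣ + (α + m) + m    ≡⟨ y+[a+m]+m≡y+2m+a ∣ Y ∣ α m ⟩
        ∣ Y ∣ + 2 * m + α      ≤⟨ +-monoˡ-≤ α ∣Y∣+2m≤n+∣NY∣ ⟩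
        n + ∣ N G Y ∣ + α      ≡⟨ cong (λ k → k + ∣ N G Y ∣ + α) α+m≡n ⟨
        α + m + ∣ N G Y ∣ + α  ≡⟨ a+m+z+a≡2a+z+m α m ∣ N G Y ∣ ⟩
        2 * α + ∣ N G Y ∣ + m  ∎)
      where
      open ≤-Reasoning
      α+m≡n : α + m ≡ n
      α+m≡n = subst (λ k → k + m ≡ n) (IsIndependenceNumber-unique a-is-α α-is-α) a+m≡n
      ∣Y∣+2m≤n+∣NY∣ : ∣ Y ∣ + 2 * m ≤ n + ∣ N G Y ∣
      ∣Y∣+2m≤n+∣NY∣ = subst (λ k → ∣ Y ∣ + 2 * k ≤ n + ∣ N G Y ∣) ∣M∣≡m (∣Y∣+2∣M∣≤n+∣NY∣ Y M-matching)
      y+[a+m]+m≡y+2m+a : ∀ y a m → y + (a + m) + m ≡ y + 2 * m + a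
      y+[a+m]+m≡y+2m+a = solve-∀
      a+m+z+a≡2a+z+m : ∀ a m z → a + m + z + a ≡ 2 * a + z + m
      a+m+z+a≡2a+z+m = solve-∀

    -- Apply the bound to Y = S ∖ N(A); then N(Y), A and S are pairwise disjoint.
    DeficiencyBound⇒HallCondition : ∀ {S} → Independent G S → ∣ S ∣ ≡ α → DeficiencyBound α →
                                    HallCondition (∁ S) S
    DeficiencyBound⇒HallCondition {S} S-independent ∣S∣≡α bound A A⊆∁S =
      +-cancelʳ-≤ (∣ S ∣ + (∣ Y ∣ + ∣ N G Y ∣)) (∣ A ∣) (∣ N G A ∩ S ∣) (begin
        ∣ A ∣ + (∣ S ∣ + (∣ Y ∣ + ∣ N G Y ∣))
          ≡⟨ a+[s+[y+z]]≡y+[z+[a+s]] (∣ A ∣) (∣ S ∣) (∣ Y ∣) (∣ N G Y ∣) ⟩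
        ∣ Y ∣ + (∣ N G Y ∣ + (∣ A ∣ + ∣ S ∣))
          ≤⟨ +-monoʳ-≤ ∣ Y ∣ ∣NY∣+∣A∣+∣S∣≤n ⟩
        ∣ Y ∣ + n
          ≤⟨ bound Y ⟩
        2 * α + ∣ N G Y ∣
          ≡⟨ cong (λ k → 2 * k + ∣ N G Y ∣) ∣S∣≡α ⟨
        2 * ∣ S ∣ + ∣ N G Y ∣
          ≡⟨ 2s+z≡s+[s+z] (∣ S ∣) (∣ N G Y ∣) ⟩
        ∣ S ∣ + (∣ S ∣ + ∣ N G Y ∣)
          ≡⟨ cong (_+ (∣ S ∣ + ∣ N G Y ∣)) ∣S∣≡∣NA∩S∣+∣Y∣ ⟩
        ∣ N G A ∩ S ∣ + ∣ Y ∣ + (∣ S ∣ + ∣ N G Y ∣)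
          ≡⟨ t+y+[s+z]≡t+[s+[y+z]] (∣ N G A ∩ S ∣) (∣ Y ∣) (∣ S ∣) (∣ N G Y ∣) ⟩
        ∣ N G A ∩ S ∣ + (∣ S ∣ + (∣ Y ∣ + ∣ N G Y ∣)) ∎)
      where
      open ≤-Reasoning
      Y : Subset n
      Y = S ─ N G A
      ∣S∣≡∣NA∩S∣+∣Y∣ : ∣ S ∣ ≡ ∣ N G A ∩ S ∣ + ∣ Y ∣
      ∣S∣≡∣NA∩S∣+∣Y∣ = trans (∣p∣≡∣p∩q∣+∣p─q∣ S (N G A)) (cong (λ X → ∣ X ∣ + ∣ Y ∣) (∩-comm S (N G A)))
      A∩S=∅ : Disjoint A S
      A∩S=∅ x∈A = x∈∁p⇒x∉p (A⊆∁S x∈A)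
      NY∩[A∪S]=∅ : Disjoint (N G Y) (A ∪ S)
      NY∩[A∪S]=∅ {x} x∈NY x∈A∪S with ∈N⁻ x∈NY
      ... | u , u∈Y , ux with x∈p─q⁻ S (N G A) u∈Y | x∈p∪q⁻ A S x∈A∪S
      ...   | u∈S , u∉NA | inj₁ x∈A = u∉NA (∈N⁺ x∈A (trans (Graph.sym G x u) ux))
      ...   | u∈S , _    | inj₂ x∈S = Independent⇒v∉S S-independent ux u∈S x∈S
      ∣NY∣+∣A∣+∣S∣≤n : ∣ N G Y ∣ + (∣ A ∣ + ∣ S ∣) ≤ n
      ∣NY∣+∣A∣+∣S∣≤n = begin
        ∣ N G Y ∣ + (∣ A ∣ + ∣ S ∣)   ≡⟨ cong (∣ N G Y ∣ +_) (Disjoint⇒∣p∪q∣≡∣p∣+∣q∣ A∩S=∅) ⟨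
        ∣ N G Y ∣ + ∣ A ∪ S ∣         ≡⟨ Disjoint⇒∣p∪q∣≡∣p∣+∣q∣ NY∩[A∪S]=∅ ⟨
        ∣ N G Y ∪ (A ∪ S) ∣           ≤⟨ ∣p∣≤n (N G Y ∪ (A ∪ S)) ⟩
        n                             ∎
      a+[s+[y+z]]≡y+[z+[a+s]] : ∀ a s y z → a + (s + (y + z)) ≡ y + (z + (a + s))
      a+[s+[y+z]]≡y+[z+[a+s]] = solve-∀
      2s+z≡s+[s+z] : ∀ s z → 2 * s + z ≡ s + (s + z)
      2s+z≡s+[s+z] = solve-∀
      t+y+[s+z]≡t+[s+[y+z]] : ∀ t y s z → t + y + (s + z) ≡ t + (s + (y + z))
      t+y+[s+z]≡t+[s+[y+z]] = solve-∀

    ∁S-matched⇒KonigEgervary : ∀ {S} → Independent G S → ∣ S ∣ ≡ α → SaturatingMatching (∁ S) S →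
                               KonigEgervary G
    ∁S-matched⇒KonigEgervary {S} S-independent ∣S∣≡α (M , M-matching , _ , ∣M∣≡∣∁S∣) =
      α , ∣ ∁ S ∣ , α-is-α , ((M , M-matching , ∣M∣≡∣∁S∣) , λ _ → Independent⇒∣M∣≤∣∁S∣ S-independent) ,
      α+∣∁S∣≡n
      where
      α+∣∁S∣≡n : α + ∣ ∁ S ∣ ≡ n
      α+∣∁S∣≡n = trans (cong (_+ ∣ ∁ S ∣) (sym ∣S∣≡α)) (∣p∣+∣∁p∣≡n S)

    DeficiencyBound⇒KonigEgervary : DeficiencyBound α → KonigEgervary G
    DeficiencyBound⇒KonigEgervary bound =
      let (S , S-independent , ∣S∣≡α) , _ = α-is-α in
      ∁S-matched⇒KonigEgervary S-independent ∣S∣≡α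
        (hall-theorem (λ x∈∁S → x∈∁p⇒x∉p x∈∁S) (DeficiencyBound⇒HallCondition S-independent ∣S∣≡α bound))

    KonigEgervary⇔DeficiencyBound : KonigEgervary G ⇔ DeficiencyBound α
    KonigEgervary⇔DeficiencyBound = mk⇔ KonigEgervary⇒DeficiencyBound DeficiencyBound⇒KonigEgervary

    DeficiencyBound⇒Critical′ : DeficiencyBound α → ∀ {S} → MaxIndependent G S → Critical′ S
    DeficiencyBound⇒Critical′ bound {S} S-max Y =
      +-cancelʳ-≤ (∣ S ∣) (∣ Y ∣ + ∣ N G S ∣) (∣ S ∣ + ∣ N G Y ∣) (begin
        ∣ Y ∣ + ∣ N G S ∣ + ∣ S ∣   ≡⟨ y+z+s≡y+[s+z] (∣ Y ∣) (∣ N G S ∣) (∣ S ∣) ⟩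
        ∣ Y ∣ + (∣ S ∣ + ∣ N G S ∣) ≡⟨ cong (∣ Y ∣ +_) (∣S∣+∣NS∣≡n S-max) ⟩
        ∣ Y ∣ + n                 ≤⟨ bound Y ⟩
        2 * α + ∣ N G Y ∣         ≡⟨ cong (λ k → 2 * k + ∣ N G Y ∣) (MaxIndependent⇒∣S∣≡α α-is-α S-max) ⟨
        2 * ∣ S ∣ + ∣ N G Y ∣     ≡⟨ 2s+z≡s+z+s (∣ S ∣) (∣ N G Y ∣) ⟩
        ∣ S ∣ + ∣ N G Y ∣ + ∣ S ∣   ∎)
      where
      open ≤-Reasoning
      y+z+s≡y+[s+z] : ∀ y z s → y + z + s ≡ y + (s + z)
      y+z+s≡y+[s+z] = solve-∀
      2s+z≡s+z+s : ∀ s z → 2 * s + z ≡ s + z + s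
      2s+z≡s+z+s = solve-∀

    module _ {Λ : List (Subset n)} (Λ-max : All (MaxIndependent G) Λ) where

      ∣⋂∣+∣⋃∣≤2α : DeficiencyBound α → ∣ ⋂ Λ ∣ + ∣ ⋃ Λ ∣ ≤ 2 * α
      ∣⋂∣+∣⋃∣≤2α bound = +-cancelʳ-≤ (∣ N G (⋃ Λ) ∣) (∣ ⋂ Λ ∣ + ∣ ⋃ Λ ∣) (2 * α) (begin
        ∣ ⋂ Λ ∣ + ∣ ⋃ Λ ∣ + ∣ N G (⋃ Λ) ∣   ≡⟨ i+x+z≡x+[i+z] (∣ ⋂ Λ ∣) (∣ ⋃ Λ ∣) (∣ N G (⋃ Λ) ∣) ⟩
        ∣ ⋃ Λ ∣ + (∣ ⋂ Λ ∣ + ∣ N G (⋃ Λ) ∣) ≡⟨ cong (∣ ⋃ Λ ∣ +_) (∣⋂∣+∣N⋃∣≡n Λ-max) ⟩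
        ∣ ⋃ Λ ∣ + n                       ≤⟨ bound (⋃ Λ) ⟩
        2 * α + ∣ N G (⋃ Λ) ∣             ∎)
        where
        open ≤-Reasoning
        i+x+z≡x+[i+z] : ∀ i x z → i + x + z ≡ x + (i + z)
        i+x+z≡x+[i+z] = solve-∀

      2α≤∣⋂∣+∣⋃∣ : ∀ {S} → MaxIndependent G S → Critical′ (⋃ Λ) → 2 * α ≤ ∣ ⋂ Λ ∣ + ∣ ⋃ Λ ∣
      2α≤∣⋂∣+∣⋃∣ {S} S-max ⋃Λ-critical = +-cancelʳ-≤ n (2 * α) (∣ ⋂ Λ ∣ + ∣ ⋃ Λ ∣) (begin
        2 * α + n
          ≡⟨ cong₂ (λ k l → 2 * k + l) (MaxIndependent⇒∣S∣≡α α-is-α S-max) (∣⋂∣+∣N⋃∣≡n Λ-max) ⟨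
        2 * ∣ S ∣ + (∣ ⋂ Λ ∣ + ∣ N G (⋃ Λ) ∣)
          ≡⟨ 2s+[i+z]≡s+z+[s+i] (∣ S ∣) (∣ ⋂ Λ ∣) (∣ N G (⋃ Λ) ∣) ⟩
        ∣ S ∣ + ∣ N G (⋃ Λ) ∣ + (∣ S ∣ + ∣ ⋂ Λ ∣)
          ≤⟨ +-monoˡ-≤ (∣ S ∣ + ∣ ⋂ Λ ∣) (⋃Λ-critical S) ⟩
        ∣ ⋃ Λ ∣ + ∣ N G S ∣ + (∣ S ∣ + ∣ ⋂ Λ ∣)
          ≡⟨ x+z+[s+i]≡i+x+[s+z] (∣ ⋃ Λ ∣) (∣ N G S ∣) (∣ S ∣) (∣ ⋂ Λ ∣) ⟩
        ∣ ⋂ Λ ∣ + ∣ ⋃ Λ ∣ + (∣ S ∣ + ∣ N G S ∣)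
          ≡⟨ cong (∣ ⋂ Λ ∣ + ∣ ⋃ Λ ∣ +_) (∣S∣+∣NS∣≡n S-max) ⟩
        ∣ ⋂ Λ ∣ + ∣ ⋃ Λ ∣ + n ∎)
        where
        open ≤-Reasoning
        2s+[i+z]≡s+z+[s+i] : ∀ s i z → 2 * s + (i + z) ≡ s + z + (s + i)
        2s+[i+z]≡s+z+[s+i] = solve-∀
        x+z+[s+i]≡i+x+[s+z] : ∀ x z s i → x + z + (s + i) ≡ i + x + (s + z)
        x+z+[s+i]≡i+x+[s+z] = solve-∀

      Critical′⇒DeficiencyBound : Critical′ (⋃ Λ) → ∣ ⋂ Λ ∣ + ∣ ⋃ Λ ∣ ≡ 2 * α → DeficiencyBound α
      Critical′⇒DeficiencyBound ⋃Λ-critical ∣⋂∣+∣⋃∣≡2α Y = begin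
        ∣ Y ∣ + n                           ≡⟨ cong (∣ Y ∣ +_) (∣⋂∣+∣N⋃∣≡n Λ-max) ⟨
        ∣ Y ∣ + (∣ ⋂ Λ ∣ + ∣ N G (⋃ Λ) ∣)     ≡⟨ y+[i+z]≡y+z+i (∣ Y ∣) (∣ ⋂ Λ ∣) (∣ N G (⋃ Λ) ∣) ⟩
        ∣ Y ∣ + ∣ N G (⋃ Λ) ∣ + ∣ ⋂ Λ ∣       ≤⟨ +-monoˡ-≤ ∣ ⋂ Λ ∣ (⋃Λ-critical Y) ⟩
        ∣ ⋃ Λ ∣ + ∣ N G Y ∣ + ∣ ⋂ Λ ∣         ≡⟨ x+z+i≡i+x+z (∣ ⋃ Λ ∣) (∣ N G Y ∣) (∣ ⋂ Λ ∣) ⟩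
        ∣ ⋂ Λ ∣ + ∣ ⋃ Λ ∣ + ∣ N G Y ∣         ≡⟨ cong (_+ ∣ N G Y ∣) ∣⋂∣+∣⋃∣≡2α ⟩
        2 * α + ∣ N G Y ∣                   ∎
        where
        open ≤-Reasoning
        y+[i+z]≡y+z+i : ∀ y i z → y + (i + z) ≡ y + z + i
        y+[i+z]≡y+z+i = solve-∀
        x+z+i≡i+x+z : ∀ x z i → x + z + i ≡ i + x + z
        x+z+i≡i+x+z = solve-∀

theorem3p6 : ∀ {n : ℕ} (G : Graph n) (Λ : List (Subset n)) (α : ℕ)
    → IsIndependenceNumber G α
    → All (MaxIndependent G) Λ
    → 1 ≤ length Λ
    → KonigEgervary G ⇔ (Critical G (⋃ Λ) × ∣ ⋂ Λ ∣ + ∣ ⋃ Λ ∣ ≡ 2 * α)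
theorem3p6 G []      α α-is-α Λ-max ()
theorem3p6 G (S ∷ Λ) α α-is-α Λ-max@(S-max ∷ _) _ = mk⇔
  (λ G-KE →
    let bound       = Equivalence.to (KonigEgervary⇔DeficiencyBound G α-is-α) G-KE
        ⋃Λ-critical = Critical′-⋃ G S Λ (All.map (DeficiencyBound⇒Critical′ G α-is-α bound) Λ-max)
    in  Equivalence.from (Critical⇔Critical′ G (⋃ (S ∷ Λ))) ⋃Λ-critical
      , ≤-antisym (∣⋂∣+∣⋃∣≤2α G α-is-α Λ-max bound) (2α≤∣⋂∣+∣⋃∣ G α-is-α Λ-max S-max ⋃Λ-critical))
  (λ (⋃Λ-critical , ∣⋂∣+∣⋃∣≡2α) →
    Equivalence.from (KonigEgervary⇔DeficiencyBound G α-is-α)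
      (Critical′⇒DeficiencyBound G α-is-α Λ-max
        (Equivalence.to (Critical⇔Critical′ G (⋃ (S ∷ Λ))) ⋃Λ-critical) ∣⋂∣+∣⋃∣≡2α))
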